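{- In $\mathbb{K}\langle \mathbf{Mag}\rangle$, let $I_{\mathrm{As}}$ be the operad ideal generated by $\mathrm{LComb}_2-\mathrm{RComb}_2$, $I_{\mathrm{AAs}}$ the operad ideal generated by $\mathrm{LComb}_2+\mathrm{RComb}_2$, $I_{2\mathrm{Nil}}$ the operad ideal generated by $\mathrm{LComb}_2$ and $\mathrm{RComb}_2$, and $I_{\mathrm{RC}_3}$ the operad ideal generated by the elements $\mathfrak{t}-\mathrm{RComb}_3$ for all binary trees $\mathfrak{t}$ with $4$ leaves. Then, writing $\mathbb{K}\langle\mathbf{As}\rangle=\mathbb{K}\langle \mathbf{Mag}\rangle/_{I_{\mathrm{As}}}$, $\mathbf{AAs}=\mathbb{K}\langle \mathbf{Mag}\rangle/_{I_{\mathrm{AAs}}}$, $2\mathbf{Nil}=\mathbb{K}\langle \mathbf{Mag}\rangle/_{I_{2\mathrm{Nil}}}$ and $\mathbb{K}\langle\mathrm{RC}_3\rangle=\mathbb{K}\langle \mathbf{Mag}\rangle/_{I_{\mathrm{RC}_3}}$, we have $\mathbb{K}\langle\mathbf{As}\rangle\wedge_{\mathrm{i}}\mathbf{AAs}=2\mathbf{Nil}$ and $\mathbb{K}\langle\mathbf{As}\rangle\vee_{\mathrm{i}}\mathbf{AAs}=\mathbb{K}\langle\mathrm{RC}_3\rangle$; that is, $I_{\mathrm{As}}+I_{\mathrm{AAs}}=I_{2\mathrm{Nil}}$ and $I_{\mathrm{As}}\cap I_{\mathrm{AAs}}=I_{\mathrm{RC}_3}$.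
   Context: $\mathbb{K}$ is a field of characteristic zero. A binary tree is either the leaf or an ordered pair of binary trees; $\mathbf{Mag}(n)$ is the set of binary trees with $n$ leaves, and the nonsymmetric operad $\mathbf{Mag}$ has partial compositions grafting the root of a tree onto the $i$-th leaf of another. $\mathbb{K}\langle \mathbf{Mag}\rangle$ is the linear operad with $\mathbb{K}\langle \mathbf{Mag}\rangle(n)$ having basis $\mathbf{Mag}(n)$. Combs: $\mathrm{LComb}_1=\mathrm{RComb}_1=(\text{leaf},\text{leaf})$, $\mathrm{LComb}_d=(\mathrm{LComb}_{d-1},\text{leaf})$, $\mathrm{RComb}_d=(\text{leaf},\mathrm{RComb}_{d-1})$. An operad ideal is a family of subspaces stable under partial composition with arbitrary elements on either side; for quotients $\mathcal{O}_j=\mathbb{K}\langle \mathbf{Mag}\rangle/_{I_j}$, $\mathcal{O}_1\wedge_{\mathrm{i}}\mathcal{O}_2:=\mathbb{K}\langle \mathbf{Mag}\rangle/_{I_1+I_2}$ and $\mathcal{O}_1\vee_{\mathrm{i}}\mathcal{O}_2:=\mathbb{K}\langle \mathbf{Mag}\rangle/_{I_1\cap I_2}$. -}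

module Defs where

open import Level using (Level; _⊔_)
open import Algebra.Bundles using (CommutativeRing)
open import Data.Nat as ℕ using (ℕ; zero; suc; _∸_; _<ᵇ_; _<_)
open import Data.Bool using (if_then_else_)
open import Data.Product using (_×_; _,_; Σ; ∃; ∃-syntax)
open import Data.List using (List; []; _∷_; _++_; map; concatMap)
open import Data.List.Relation.Unary.All using (All)
open import Relation.Nullary using (¬_; Dec; yes; no)
open import Relation.Binary.PropositionalEquality using (_≡_; refl; cong₂)
open import Function.Bundles using (_⇔_)

record Field (c ℓ : Level) : Set (Level.suc (c ⊔ ℓ)) where
  field
    commutativeRing : CommutativeRing c ℓ
  open CommutativeRing commutativeRing public
  field
    1≉0     : ¬ (1# ≈ 0#)
    inverse : ∀ x → ¬ (x ≈ 0#) → ∃[ y ] (x * y ≈ 1#)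

  ⟦_⟧ℕ : ℕ → Carrier
  ⟦ zero ⟧ℕ  = 0#
  ⟦ suc n ⟧ℕ = 1# + ⟦ n ⟧ℕ

CharZero : ∀ {c ℓ} → Field c ℓ → Set ℓ
CharZero F = ∀ n → ¬ (⟦ suc n ⟧ℕ ≈ 0#)
  where open Field F

-- Binary trees (the magmatic operad Mag)

data Tree : Set where
  leaf : Tree
  node : Tree → Tree → Tree

leaves : Tree → ℕ
leaves leaf       = 1
leaves (node l r) = leaves l ℕ.+ leaves r

-- graft s onto the i-th leaf (0-indexed, left to right) of t
-- (only used for i < leaves t; t is unchanged otherwise)
graft : Tree → ℕ → Tree → Tree
graft leaf zero    s = s
graft leaf (suc i) s = leaf
graft (node l r) i s =
  if i <ᵇ leaves l then node (graft l i s) r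
                   else node l (graft r (i ∸ leaves l) s)

_≟T_ : (s t : Tree) → Dec (s ≡ t)
leaf ≟T leaf = yes refl
leaf ≟T node _ _ = no λ ()
node _ _ ≟T leaf = no λ ()
node l r ≟T node l' r' with l ≟T l' | r ≟T r'
... | yes refl | yes refl = yes refl
... | no p     | _        = no λ { refl → p refl }
... | yes _    | no q     = no λ { refl → q refl }

LComb₂ RComb₂ RComb₃ : Tree
LComb₂ = node (node leaf leaf) leaf
RComb₂ = node leaf (node leaf leaf)
RComb₃ = node leaf RComb₂

-- An element of K⟨Mag⟩(n) is a formal linear combination (list of
-- coefficient/tree pairs) all of whose trees have n leaves; two formal
-- combinations are equal when all their coefficients agree.

module LinMag {c ℓ} (F : Field c ℓ) where
  open Field F

  FS : Set c
  FS = List (Carrier × Tree)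

  Hom : ℕ → FS → Set c
  Hom n x = All (λ p → leaves (Data.Product.proj₂ p) ≡ n) x

  coeff : FS → Tree → Carrier
  coeff [] t = 0#
  coeff ((a , s) ∷ x) t with s ≟T t
  ... | yes _ = a + coeff x t
  ... | no _  = coeff x t

  _≋_ : FS → FS → Set ℓ
  x ≋ y = ∀ t → coeff x t ≈ coeff y t

  _·_ : Carrier → FS → FS
  a · x = map (λ { (b , t) → (a * b , t) }) x

  -- bilinear extension of the partial composition ∘ᵢ (0-indexed)
  _∘[_]_ : FS → ℕ → FS → FS
  x ∘[ i ] y = concatMap (λ { (a , s) → map (λ { (b , t) → (a * b , graft s i t) }) y }) x

  data ⟨_⟩ (G : ℕ → FS → Set (c ⊔ ℓ)) : ℕ → FS → Set (c ⊔ ℓ) where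
    gen   : ∀ {n x} → G n x → ⟨ G ⟩ n x
    zer   : ∀ {n} → ⟨ G ⟩ n []
    add   : ∀ {n x y} → ⟨ G ⟩ n x → ⟨ G ⟩ n y → ⟨ G ⟩ n (x ++ y)
    scale : ∀ {n x} a → ⟨ G ⟩ n x → ⟨ G ⟩ n (a · x)
    resp  : ∀ {n x y} → x ≋ y → Hom n y → ⟨ G ⟩ n x → ⟨ G ⟩ n y
    compL : ∀ {n m x y i} → i < n → ⟨ G ⟩ n x → Hom m y →
            ⟨ G ⟩ (n ℕ.+ m ∸ 1) (x ∘[ i ] y)
    compR : ∀ {n m x y i} → i < n → Hom n x → ⟨ G ⟩ m y →
            ⟨ G ⟩ (n ℕ.+ m ∸ 1) (x ∘[ i ] y)

  data G-As : ℕ → FS → Set (c ⊔ ℓ) where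
    g : G-As 3 ((1# , LComb₂) ∷ (- 1# , RComb₂) ∷ [])

  data G-AAs : ℕ → FS → Set (c ⊔ ℓ) where
    g : G-AAs 3 ((1# , LComb₂) ∷ (1# , RComb₂) ∷ [])

  data G-2Nil : ℕ → FS → Set (c ⊔ ℓ) where
    gL : G-2Nil 3 ((1# , LComb₂) ∷ [])
    gR : G-2Nil 3 ((1# , RComb₂) ∷ [])

  data G-RC₃ : ℕ → FS → Set (c ⊔ ℓ) where
    g : ∀ t → leaves t ≡ 4 → G-RC₃ 4 ((1# , t) ∷ (- 1# , RComb₃) ∷ [])

  I-As I-AAs I-2Nil I-RC₃ : ℕ → FS → Set (c ⊔ ℓ)
  I-As   = ⟨ G-As ⟩
  I-AAs  = ⟨ G-AAs ⟩
  I-2Nil = ⟨ G-2Nil ⟩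
  I-RC₃  = ⟨ G-RC₃ ⟩

  _+I_ : (I J : ℕ → FS → Set (c ⊔ ℓ)) → ℕ → FS → Set (c ⊔ ℓ)
  (I +I J) n x = ∃[ y ] ∃[ z ] (I n y × J n z × x ≋ (y ++ z))

  _∩I_ : (I J : ℕ → FS → Set (c ⊔ ℓ)) → ℕ → FS → Set (c ⊔ ℓ)
  (I ∩I J) n x = I n x × J n x

  _≐_ : (I J : ℕ → FS → Set (c ⊔ ℓ)) → Set (c ⊔ ℓ)
  I ≐ J = ∀ n x → Hom n x → (I n x ⇔ J n x)

-- All four ideals are homogeneous and vanish below arity 3, so both identities are
-- checked arity by arity. In arity 3 an element is cL·LComb₂ + cR·RComb₂: as 2 is
-- invertible it is a combination of the generators LComb₂ ∓ RComb₂, while the weight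
-- cL + cR vanishes on I_As and cL − cR vanishes on I_AAs (its lowest arity), so
-- I_As ∩ I_AAs is zero there. Grafting a cherry into the AAs generator gives relations
-- s + t ≡ 0 along the edges of the pentagon of 4-leaf trees; an odd cycle forces every
-- 4-leaf tree, hence every tree with at least 4 leaves, into I_AAs. Modulo I_As, resp.
-- I_RC₃, rotations make every tree with at least 3, resp. 4, leaves congruent to the
-- right comb; so I_RC₃ ⊆ I_As, and from arity 4 on I_RC₃ contains every element of
-- weight zero, in particular every element of I_As.

module Submission where

open import Level using (0ℓ; _⊔_)
open import Algebra.Bundles using (CommutativeRing; RawRing)
open import Algebra.Solver.Ring.AlmostCommutativeRing using (fromCommutativeRing; _-Raw-AlmostCommutative⟶_)
open import Data.Maybe using (Maybe; just; nothing)
open import Data.Bool using (true; false)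
open import Data.Empty using (⊥-elim)
open import Data.Nat as ℕ using (ℕ; zero; suc; _∸_; _<ᵇ_; _≤_; _<_; z≤n; s≤s)
import Data.Nat.Properties as ℕ
open import Data.List using (List; []; _∷_; [_]; _++_; length; map)
open import Data.List.Properties using (++-identityʳ)
open import Data.List.Relation.Unary.All using (All; []; _∷_)
import Data.List.Relation.Unary.All as All
import Data.List.Relation.Unary.All.Properties as All
open import Data.List.Relation.Binary.Pointwise as Pointwise using (Pointwise; []; _∷_)
open import Data.Product using (_×_; _,_; proj₁; proj₂; map₂; Σ-syntax; ∃-syntax)
open import Data.Product.Properties using (≡-dec)
open import Data.Sum using (_⊎_; inj₁; inj₂)
open import Relation.Nullary using (¬_; yes; no; ofʸ; ofⁿ)
open import Relation.Binary.Structures using (IsEquivalence)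
open import Relation.Binary.Definitions using (tri<; tri≈; tri>)
open import Function.Base using (_∘_)
open import Function.Bundles using (mk⇔)
open import Relation.Binary.PropositionalEquality as ≡ using (_≡_; _≢_; cong₂)
open import Algebra.Properties.CommutativeSemigroup ℕ.+-commutativeSemigroup using () renaming (xy∙z≈xz∙y to +-xy∙z≈xz∙y)

open import Defs

module IntegerCoefficientRingSolver {c ℓ} (R : CommutativeRing c ℓ) where
  open CommutativeRing R
  open import Algebra.Properties.Ring ring using (-0#≈0#; -‿+-comm; ⁻¹-anti-homo‿-; x[y-z]≈xy-xz; [y-z]x≈yx-zx)
  open import Algebra.Properties.CommutativeSemigroup +-commutativeSemigroup using (interchange)
  open import Algebra.Properties.Semiring.Mult semiring renaming (_×_ to _×ᴿ_) using (×-homo-+; ×1-homo-*)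
  open import Relation.Binary.Reasoning.Setoid setoid

  private
    -- The pair (a , b) stands for the integer a - b. Results are kept canonical
    -- (one component zero) because the solver compares coefficients syntactically.
    canonical : ℕ → ℕ → ℕ × ℕ
    canonical a b = a ∸ b , b ∸ a

    ℤ-rawRing : RawRing 0ℓ 0ℓ
    ℤ-rawRing = record
      { Carrier = ℕ × ℕ
      ; _≈_     = _≡_
      ; _+_     = λ { (a , b) (c , d) → canonical (a ℕ.+ c) (b ℕ.+ d) }
      ; _*_     = λ { (a , b) (c , d) → canonical (a ℕ.* c ℕ.+ b ℕ.* d) (a ℕ.* d ℕ.+ b ℕ.* c) }
      ; -_      = λ { (a , b) → b , a }
      ; 0#      = 0 , 0
      ; 1#      = 1 , 0
      }

    value : ℕ × ℕ → Carrier
    value (a , b) = a ×ᴿ 1# - b ×ᴿ 1#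

    -- agrees with value, but is 0# and 1# on the nose, as the solver's constants need
    ⟦_⟧ : ℕ × ℕ → Carrier
    ⟦ 0 , 0 ⟧ = 0#
    ⟦ 1 , 0 ⟧ = 1#
    ⟦ p ⟧     = value p

    ⟦⟧≈value : ∀ p → ⟦ p ⟧ ≈ value p
    ⟦⟧≈value (zero , zero)        = sym (-‿inverseʳ 0#)
    ⟦⟧≈value (zero , suc b)       = refl
    ⟦⟧≈value (suc zero , zero)    = sym (trans (+-congʳ (+-identityʳ 1#)) (trans (+-congˡ -0#≈0#) (+-identityʳ 1#)))
    ⟦⟧≈value (suc zero , suc b)   = refl
    ⟦⟧≈value (suc (suc a) , b)    = refl

    [x+y]-[z+w]≈[x-z]+[y-w] : ∀ x y z w → (x + y) - (z + w) ≈ (x - z) + (y - w)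
    [x+y]-[z+w]≈[x-z]+[y-w] x y z w = trans (+-congˡ (sym (-‿+-comm z w))) (interchange x y (- z) (- w))

    [xz+yw]-[xw+yz]≈[x-y][z-w] : ∀ x y z w → (x * z + y * w) - (x * w + y * z) ≈ (x - y) * (z - w)
    [xz+yw]-[xw+yz]≈[x-y][z-w] x y z w = sym (begin
      (x - y) * (z - w)                      ≈⟨ x[y-z]≈xy-xz (x - y) z w ⟩
      (x - y) * z - (x - y) * w              ≈⟨ +-cong ([y-z]x≈yx-zx z x y) (-‿cong ([y-z]x≈yx-zx w x y)) ⟩
      (x * z - y * z) - (x * w - y * w)      ≈⟨ +-congˡ (⁻¹-anti-homo‿- (x * w) (y * w)) ⟩
      (x * z - y * z) + (y * w - x * w)      ≈⟨ interchange (x * z) (- (y * z)) (y * w) (- (x * w)) ⟩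
      (x * z + y * w) + (- (y * z) - x * w)  ≈⟨ +-congˡ (-‿+-comm (y * z) (x * w)) ⟩
      (x * z + y * w) - (y * z + x * w)      ≈⟨ +-congˡ (-‿cong (+-comm (y * z) (x * w))) ⟩
      (x * z + y * w) - (x * w + y * z)      ∎)

    value-canonical : ∀ a b → value (canonical a b) ≈ value (a , b)
    value-canonical zero    zero    = refl
    value-canonical zero    (suc b) = refl
    value-canonical (suc a) zero    = refl
    value-canonical (suc a) (suc b) = begin
      value (canonical a b)                    ≈⟨ value-canonical a b ⟩
      a ×ᴿ 1# - b ×ᴿ 1#                        ≈⟨ +-identityˡ _ ⟨
      0# + (a ×ᴿ 1# - b ×ᴿ 1#)                 ≈⟨ +-congʳ (-‿inverseʳ 1#) ⟨
      (1# - 1#) + (a ×ᴿ 1# - b ×ᴿ 1#)          ≈⟨ [x+y]-[z+w]≈[x-z]+[y-w] 1# _ 1# _ ⟨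
      value (suc a , suc b)                    ∎

    ⟦canonical⟧ : ∀ a b → ⟦ canonical a b ⟧ ≈ a ×ᴿ 1# - b ×ᴿ 1#
    ⟦canonical⟧ a b = trans (⟦⟧≈value (canonical a b)) (value-canonical a b)

    homomorphism : ℤ-rawRing -Raw-AlmostCommutative⟶ fromCommutativeRing R
    homomorphism = record
      { ⟦_⟧    = ⟦_⟧
      ; +-homo = λ { (a , b) (c , d) → begin
          ⟦ canonical (a ℕ.+ c) (b ℕ.+ d) ⟧            ≈⟨ ⟦canonical⟧ (a ℕ.+ c) (b ℕ.+ d) ⟩
          (a ℕ.+ c) ×ᴿ 1# - (b ℕ.+ d) ×ᴿ 1#            ≈⟨ +-cong (×-homo-+ 1# a c) (-‿cong (×-homo-+ 1# b d)) ⟩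
          (a ×ᴿ 1# + c ×ᴿ 1#) - (b ×ᴿ 1# + d ×ᴿ 1#)    ≈⟨ [x+y]-[z+w]≈[x-z]+[y-w] _ _ _ _ ⟩
          value (a , b) + value (c , d)                ≈⟨ +-cong (⟦⟧≈value (a , b)) (⟦⟧≈value (c , d)) ⟨
          ⟦ a , b ⟧ + ⟦ c , d ⟧                          ∎ }
      ; *-homo = λ { (a , b) (c , d) → begin
          ⟦ canonical (a ℕ.* c ℕ.+ b ℕ.* d) (a ℕ.* d ℕ.+ b ℕ.* c) ⟧
            ≈⟨ ⟦canonical⟧ (a ℕ.* c ℕ.+ b ℕ.* d) (a ℕ.* d ℕ.+ b ℕ.* c) ⟩
          (a ℕ.* c ℕ.+ b ℕ.* d) ×ᴿ 1# - (a ℕ.* d ℕ.+ b ℕ.* c) ×ᴿ 1#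
            ≈⟨ +-cong (trans (×-homo-+ 1# (a ℕ.* c) (b ℕ.* d)) (+-cong (×1-homo-* a c) (×1-homo-* b d)))
                      (-‿cong (trans (×-homo-+ 1# (a ℕ.* d) (b ℕ.* c)) (+-cong (×1-homo-* a d) (×1-homo-* b c)))) ⟩
          (a ×ᴿ 1# * c ×ᴿ 1# + b ×ᴿ 1# * d ×ᴿ 1#) - (a ×ᴿ 1# * d ×ᴿ 1# + b ×ᴿ 1# * c ×ᴿ 1#)
            ≈⟨ [xz+yw]-[xw+yz]≈[x-y][z-w] _ _ _ _ ⟩
          value (a , b) * value (c , d)
            ≈⟨ *-cong (⟦⟧≈value (a , b)) (⟦⟧≈value (c , d)) ⟨
          ⟦ a , b ⟧ * ⟦ c , d ⟧ ∎ }
      ; -‿homo = λ { (a , b) → trans (⟦⟧≈value (b , a))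
                     (trans (sym (⁻¹-anti-homo‿- _ _)) (-‿cong (sym (⟦⟧≈value (a , b))))) }
      ; 0-homo = refl
      ; 1-homo = refl
      }

    _≟ℤ_ : ∀ p q → Maybe (⟦ p ⟧ ≈ ⟦ q ⟧)
    p ≟ℤ q with ≡-dec ℕ._≟_ ℕ._≟_ p q
    ... | yes ≡.refl = just refl
    ... | no _       = nothing

  open import Algebra.Solver.Ring ℤ-rawRing (fromCommutativeRing R) homomorphism _≟ℤ_ public
    using (solve; _:=_; Polynomial; con; _:+_; _:*_; :-_; _:-_)

C₂ : Tree
C₂ = node leaf leaf

RComb : ℕ → Tree
RComb zero    = leaf
RComb (suc n) = node leaf (RComb n)

leaves-RComb : ∀ n → leaves (RComb n) ≡ suc n
leaves-RComb zero    = ≡.refl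
leaves-RComb (suc n) = ≡.cong suc (leaves-RComb n)

leaves-positive : ∀ t → 1 ≤ leaves t
leaves-positive leaf       = s≤s z≤n
leaves-positive (node l r) = ℕ.≤-trans (leaves-positive l) (ℕ.m≤m+n (leaves l) (leaves r))

leaves≢0 : ∀ t → leaves t ≢ 0
leaves≢0 t e = ℕ.<⇒≢ (leaves-positive t) (≡.sym e)

leaves≡1 : ∀ t → leaves t ≡ 1 → t ≡ leaf
leaves≡1 leaf       _ = ≡.refl
leaves≡1 (node l r) e with leaves l in el | leaves r in er
... | zero  | _     = ⊥-elim (leaves≢0 l el)
... | suc _ | zero  = ⊥-elim (leaves≢0 r er)
leaves≡1 (node l r) () | 1           | suc _
leaves≡1 (node l r) () | suc (suc _) | suc _

leaves≡2 : ∀ t → leaves t ≡ 2 → t ≡ C₂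
leaves≡2 (node l r) e with leaves l in el | leaves r in er
... | zero  | _     = ⊥-elim (leaves≢0 l el)
... | suc _ | zero  = ⊥-elim (leaves≢0 r er)
... | 1     | 1     = cong₂ node (leaves≡1 l el) (leaves≡1 r er)
leaves≡2 (node l r) () | 1                 | suc (suc _)
leaves≡2 (node l r) () | 2                 | suc _
leaves≡2 (node l r) () | suc (suc (suc _)) | suc _

leaves≡3 : ∀ t → leaves t ≡ 3 → t ≡ LComb₂ ⊎ t ≡ RComb₂
leaves≡3 (node l r) e with leaves l in el | leaves r in er
... | zero  | _     = ⊥-elim (leaves≢0 l el)
... | suc _ | zero  = ⊥-elim (leaves≢0 r er)
... | 2     | 1     = inj₁ (cong₂ node (leaves≡2 l el) (leaves≡1 r er))
... | 1     | 2     = inj₂ (cong₂ node (leaves≡1 l el) (leaves≡2 r er))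
leaves≡3 (node l r) () | 1                       | 1
leaves≡3 (node l r) () | 1                       | suc (suc (suc _))
leaves≡3 (node l r) () | 2                       | suc (suc _)
leaves≡3 (node l r) () | 3                       | suc _
leaves≡3 (node l r) () | suc (suc (suc (suc _))) | suc _

graft-leaf : ∀ s i → graft s i leaf ≡ s
graft-leaf leaf       zero    = ≡.refl
graft-leaf leaf       (suc i) = ≡.refl
graft-leaf (node l r) i with i <ᵇ leaves l
... | true  = ≡.cong (λ l′ → node l′ r) (graft-leaf l i)
... | false = ≡.cong (node l) (graft-leaf r (i ∸ leaves l))

leaves-graft : ∀ s i u → i < leaves s → suc (leaves (graft s i u)) ≡ leaves s ℕ.+ leaves u
leaves-graft leaf       zero    u _ = ≡.refl
leaves-graft leaf       (suc i) u (s≤s ())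
leaves-graft (node l r) i       u i<s with i <ᵇ leaves l | ℕ.<ᵇ-reflects-< i (leaves l)
... | true  | ofʸ i<l = begin
  suc (leaves (graft l i u)) ℕ.+ leaves r  ≡⟨ ≡.cong (ℕ._+ leaves r) (leaves-graft l i u i<l) ⟩
  leaves l ℕ.+ leaves u ℕ.+ leaves r        ≡⟨ +-xy∙z≈xz∙y (leaves l) (leaves u) (leaves r) ⟩
  leaves l ℕ.+ leaves r ℕ.+ leaves u        ∎
  where open ≡.≡-Reasoning
... | false | ofⁿ i≮l = begin
  suc (leaves l ℕ.+ leaves (graft r (i ∸ leaves l) u))  ≡⟨ ℕ.+-suc (leaves l) _ ⟨
  leaves l ℕ.+ suc (leaves (graft r (i ∸ leaves l) u))
    ≡⟨ ≡.cong (leaves l ℕ.+_) (leaves-graft r (i ∸ leaves l) u i∸l<r) ⟩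
  leaves l ℕ.+ (leaves r ℕ.+ leaves u)                    ≡⟨ ℕ.+-assoc (leaves l) (leaves r) (leaves u) ⟨
  leaves l ℕ.+ leaves r ℕ.+ leaves u                      ∎
  where
  open ≡.≡-Reasoning
  i∸l<r : i ∸ leaves l < leaves r
  i∸l<r = ≡.subst (i ∸ leaves l <_) (ℕ.m+n∸m≡n (leaves l) (leaves r))
            (ℕ.∸-monoˡ-< i<s (ℕ.≮⇒≥ i≮l))

-- fill T a b c d = T(a, b, c, d); grafting from the last leaf leftwards keeps the
-- positions of the leaves still to be filled unchanged.
fill : Tree → Tree → Tree → Tree → Tree → Tree
fill T a b c d = graft (graft (graft (graft T 3 d) 2 c) 1 b) 0 a

T₁ T₂ T₃ T₄ T₅ : Tree
T₁ = node LComb₂ leaf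
T₂ = node RComb₂ leaf
T₃ = node C₂ C₂
T₄ = node leaf LComb₂
T₅ = RComb₃

data FourLeaf : Tree → Set where
  t₁ : FourLeaf T₁
  t₂ : FourLeaf T₂
  t₃ : FourLeaf T₃
  t₄ : FourLeaf T₄
  t₅ : FourLeaf T₅

data FilledFourLeaf : Tree → Set where
  filled : ∀ {T} → FourLeaf T → ∀ a b c d → FilledFourLeaf (fill T a b c d)

filled-four-leaf : ∀ t → 4 ≤ leaves t → FilledFourLeaf t
filled-four-leaf (node (node a b) (node c d))      _ = filled t₃ a b c d
filled-four-leaf (node (node (node a b) c) leaf)    _ = filled t₁ a b c leaf
filled-four-leaf (node (node a (node b c)) leaf)    _ = filled t₂ a b c leaf
filled-four-leaf (node leaf (node (node b c) d))    _ = filled t₄ leaf b c d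
filled-four-leaf (node leaf (node leaf (node c d))) _ = filled t₅ leaf leaf c d
filled-four-leaf leaf                               (s≤s ())
filled-four-leaf (node leaf leaf)                   (s≤s (s≤s ()))
filled-four-leaf (node leaf (node leaf leaf))       (s≤s (s≤s (s≤s ())))
filled-four-leaf (node (node leaf leaf) leaf)       (s≤s (s≤s (s≤s ())))

module RightCombNormalForm
  {p} {_∼_ : Tree → Tree → Set p} (∼-isEquivalence : IsEquivalence _∼_) (n₀ : ℕ)
  (rotate : ∀ a b c → suc n₀ ≤ leaves a ℕ.+ leaves b ℕ.+ leaves c → node (node a b) c ∼ node a (node b c))
  (∼-node-leaf : ∀ {s t} → s ∼ t → node leaf s ∼ node leaf t)
  (base : ∀ t → leaves t ≡ suc n₀ → t ∼ RComb n₀)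
  where
  open IsEquivalence ∼-isEquivalence

  left-leaf : ∀ l r → suc n₀ ≤ leaves l ℕ.+ leaves r →
              Σ[ r′ ∈ Tree ] node l r ∼ node leaf r′ × suc (leaves r′) ≡ leaves l ℕ.+ leaves r
  left-leaf leaf       r _  = r , refl , ≡.refl
  left-leaf (node a b) r le with left-leaf a (node b r) (≡.subst (suc n₀ ≤_) (ℕ.+-assoc (leaves a) (leaves b) (leaves r)) le)
  ... | r′ , a[br]∼ , e =
    r′ , trans (rotate a b r le) a[br]∼ , ≡.trans e (≡.sym (ℕ.+-assoc (leaves a) (leaves b) (leaves r)))

  ∼RComb : ∀ n t → leaves t ≡ suc n → n₀ ≤ n → t ∼ RComb n
  ∼RComb n t e n₀≤n with n₀ ℕ.≟ n
  ... | yes ≡.refl = base t e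
  ∼RComb zero t e n₀≤0 | no n₀≢0 = ⊥-elim (n₀≢0 (ℕ.n≤0⇒n≡0 n₀≤0))
  ∼RComb (suc n) (node l r) e n₀≤1+n | no n₀≢1+n
    with left-leaf l r (≡.subst (suc n₀ ≤_) (≡.sym e) (s≤s n₀≤1+n))
  ... | r′ , t∼ , e′ = trans t∼ (∼-node-leaf (∼RComb n r′ (ℕ.suc-injective (≡.trans e′ e)) n₀≤n))
    where
    n₀≤n : n₀ ≤ n
    n₀≤n = ℕ.≤-pred (ℕ.≤∧≢⇒< n₀≤1+n n₀≢1+n)

module _ {c ℓ} (F : Field c ℓ) where
  open Field F
  open LinMag F
  open IntegerCoefficientRingSolver commutativeRing
  open import Algebra.Properties.Ring ring using (-0#≈0#; -1*x≈-x; x∙y⁻¹≈ε⇒x≈y)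
  open import Algebra.Properties.CommutativeSemigroup +-commutativeSemigroup using (x∙yz≈y∙xz)
  open import Relation.Binary.Reasoning.Setoid setoid

  𝟘 𝟙 : ∀ {n} → Polynomial n
  𝟘 = con (0 , 0)
  𝟙 = con (1 , 0)

  -- Formal sums and linear functionals on them

  δ : Tree → Tree → Carrier
  δ t s with s ≟T t
  ... | yes _ = 1#
  ... | no  _ = 0#

  extend : (Tree → Carrier) → FS → Carrier
  extend φ []            = 0#
  extend φ ((a , s) ∷ x) = a * φ s + extend φ x

  weight : FS → Carrier
  weight = extend (λ _ → 1#)

  coeff≈extend-δ : ∀ x t → coeff x t ≈ extend (δ t) x
  coeff≈extend-δ []            t = refl
  coeff≈extend-δ ((a , s) ∷ x) t with s ≟T t
  ... | yes _ = +-cong (sym (*-identityʳ a)) (coeff≈extend-δ x t)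
  ... | no  _ = trans (coeff≈extend-δ x t) (sym (trans (+-congʳ (zeroʳ a)) (+-identityˡ _)))

  ≋-by-δ : ∀ x y → (∀ t → extend (δ t) x ≈ extend (δ t) y) → x ≋ y
  ≋-by-δ x y h t = trans (coeff≈extend-δ x t) (trans (h t) (sym (coeff≈extend-δ y t)))

  extend-++ : ∀ φ x y → extend φ (x ++ y) ≈ extend φ x + extend φ y
  extend-++ φ []            y = sym (+-identityˡ _)
  extend-++ φ ((a , s) ∷ x) y = trans (+-congˡ (extend-++ φ x y)) (sym (+-assoc _ _ _))

  extend-· : ∀ φ b x → extend φ (b · x) ≈ b * extend φ x
  extend-· φ b []            = sym (zeroʳ b)
  extend-· φ b ((a , s) ∷ x) = trans (+-cong (*-assoc b a _) (extend-· φ b x)) (sym (distribˡ b _ _))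

  extend-cong : ∀ {φ ψ} x → All (λ p → φ (proj₂ p) ≈ ψ (proj₂ p)) x → extend φ x ≈ extend ψ x
  extend-cong []            []       = refl
  extend-cong ((a , s) ∷ x) (e ∷ es) = +-cong (*-congˡ e) (extend-cong x es)

  extend-*ʳ : ∀ φ b x → extend (λ s → φ s * b) x ≈ extend φ x * b
  extend-*ʳ φ b []            = sym (zeroˡ b)
  extend-*ʳ φ b ((a , s) ∷ x) =
    trans (+-cong (sym (*-assoc a _ b)) (extend-*ʳ φ b x)) (sym (distribʳ b _ _))

  extend-const : ∀ b x → extend (λ _ → b) x ≈ weight x * b
  extend-const b x = trans (extend-cong x (All.universal (λ _ → sym (*-identityˡ b)) x)) (extend-*ʳ (λ _ → 1#) b x)

  coeff-++ : ∀ x y t → coeff (x ++ y) t ≈ coeff x t + coeff y t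
  coeff-++ x y t = begin
    coeff (x ++ y) t                          ≈⟨ coeff≈extend-δ (x ++ y) t ⟩
    extend (δ t) (x ++ y)                     ≈⟨ extend-++ (δ t) x y ⟩
    extend (δ t) x + extend (δ t) y           ≈⟨ +-cong (coeff≈extend-δ x t) (coeff≈extend-δ y t) ⟨
    coeff x t + coeff y t                     ∎

  coeff-· : ∀ b x t → coeff (b · x) t ≈ b * coeff x t
  coeff-· b x t = begin
    coeff (b · x) t          ≈⟨ coeff≈extend-δ (b · x) t ⟩
    extend (δ t) (b · x)     ≈⟨ extend-· (δ t) b x ⟩
    b * extend (δ t) x       ≈⟨ *-congˡ (coeff≈extend-δ x t) ⟨
    b * coeff x t            ∎

  coeff-≢ : ∀ a {s t} x → s ≢ t → coeff ((a , s) ∷ x) t ≡ coeff x t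
  coeff-≢ a {s} {t} x s≢t with s ≟T t
  ... | yes s≡t = ⊥-elim (s≢t s≡t)
  ... | no  _   = ≡.refl

  remove : Tree → FS → FS
  remove s []            = []
  remove s ((a , u) ∷ x) with u ≟T s
  ... | yes _ = remove s x
  ... | no  _ = (a , u) ∷ remove s x

  length-remove : ∀ s x → length (remove s x) ≤ length x
  length-remove s []            = z≤n
  length-remove s ((a , u) ∷ x) with u ≟T s
  ... | yes _ = ℕ.m≤n⇒m≤1+n (length-remove s x)
  ... | no  _ = s≤s (length-remove s x)

  coeff-remove-same : ∀ s x → coeff (remove s x) s ≈ 0#
  coeff-remove-same s []            = refl
  coeff-remove-same s ((a , u) ∷ x) with u ≟T s
  ... | yes _   = coeff-remove-same s x
  ... | no  u≢s = trans (reflexive (coeff-≢ a (remove s x) u≢s)) (coeff-remove-same s x)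

  coeff-remove-other : ∀ s x {t} → s ≢ t → coeff (remove s x) t ≈ coeff x t
  coeff-remove-other s []            s≢t = refl
  coeff-remove-other s ((a , u) ∷ x) {t} s≢t with u ≟T s
  ... | yes ≡.refl = trans (coeff-remove-other s x s≢t) (reflexive (≡.sym (coeff-≢ a x s≢t)))
  ... | no  _ with u ≟T t
  ...   | yes _ = +-congˡ (coeff-remove-other s x s≢t)
  ...   | no  _ = coeff-remove-other s x s≢t

  extend-remove : ∀ φ s x → extend φ x ≈ coeff x s * φ s + extend φ (remove s x)
  extend-remove φ s []            = sym (trans (+-congʳ (zeroˡ (φ s))) (+-identityʳ 0#))
  extend-remove φ s ((a , u) ∷ x) with u ≟T s
  ... | yes ≡.refl = trans (+-congˡ (extend-remove φ u x))
                       (solve 4 (λ a p q r → a :* p :+ (q :* p :+ r) := (a :+ q) :* p :+ r) refl a (φ u) _ _)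
  ... | no  _      = trans (+-congˡ (extend-remove φ s x)) (x∙yz≈y∙xz _ _ _)

  extend-null : ∀ φ x → x ≋ [] → extend φ x ≈ 0#
  extend-null φ x = bounded (length x) x ℕ.≤-refl
    where
    bounded : ∀ n x → length x ≤ n → x ≋ [] → extend φ x ≈ 0#
    bounded _       []            _          _   = refl
    bounded (suc n) ((a , s) ∷ x) (s≤s |x|≤n) x≋0 = begin
      a * φ s + extend φ x                                ≈⟨ +-congˡ (extend-remove φ s x) ⟩
      a * φ s + (coeff x s * φ s + extend φ (remove s x))  ≈⟨ +-assoc _ _ _ ⟨
      (a * φ s + coeff x s * φ s) + extend φ (remove s x)  ≈⟨ +-congʳ (distribʳ (φ s) a (coeff x s)) ⟨
      (a + coeff x s) * φ s + extend φ (remove s x)       ≈⟨ +-cong (*-congʳ head≈0) rest≈0 ⟩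
      0# * φ s + 0#                                       ≈⟨ trans (+-identityʳ _) (zeroˡ (φ s)) ⟩
      0#                                                  ∎
      where
      head≈0 : a + coeff x s ≈ 0#
      head≈0 with s ≟T s | x≋0 s
      ... | yes _   | e = e
      ... | no  s≢s | _ = ⊥-elim (s≢s ≡.refl)
      rest≋0 : remove s x ≋ []
      rest≋0 t with s ≟T t
      ... | yes ≡.refl = coeff-remove-same s x
      ... | no  s≢t    = trans (coeff-remove-other s x s≢t) (trans (reflexive (≡.sym (coeff-≢ a x s≢t))) (x≋0 t))
      rest≈0 : extend φ (remove s x) ≈ 0#
      rest≈0 = bounded n (remove s x) (ℕ.≤-trans (length-remove s x) |x|≤n) rest≋0

  extend-resp-≋ : ∀ φ {x y} → x ≋ y → extend φ x ≈ extend φ y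
  extend-resp-≋ φ {x} {y} x≋y = x∙y⁻¹≈ε⇒x≈y _ _ (begin
    extend φ x - extend φ y              ≈⟨ +-congˡ (-1*x≈-x _) ⟨
    extend φ x + - 1# * extend φ y       ≈⟨ +-congˡ (extend-· φ (- 1#) y) ⟨
    extend φ x + extend φ ((- 1#) · y)     ≈⟨ extend-++ φ x ((- 1#) · y) ⟨
    extend φ (x ++ (- 1#) · y)             ≈⟨ extend-null φ (x ++ (- 1#) · y) difference≋0 ⟩
    0#                                   ∎)
    where
    difference≋0 : (x ++ (- 1#) · y) ≋ []
    difference≋0 t = begin
      coeff (x ++ (- 1#) · y) t            ≈⟨ coeff-++ x ((- 1#) · y) t ⟩
      coeff x t + coeff ((- 1#) · y) t     ≈⟨ +-congˡ (trans (coeff-· (- 1#) y t) (-1*x≈-x _)) ⟩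
      coeff x t - coeff y t              ≈⟨ +-congʳ (x≋y t) ⟩
      coeff y t - coeff y t              ≈⟨ -‿inverseʳ _ ⟩
      0#                                 ∎

  extend-zero : ∀ x → extend (λ _ → 0#) x ≈ 0#
  extend-zero x = trans (extend-const 0# x) (zeroʳ (weight x))

  ∘-cons : ∀ i a s x y → ((a , s) ∷ x) ∘[ i ] y ≡ ([ a , s ] ∘[ i ] y) ++ (x ∘[ i ] y)
  ∘-cons i a s x y = ≡.cong (_++ (x ∘[ i ] y)) (≡.sym (++-identityʳ _))

  extend-∘ : ∀ φ i x y → extend φ (x ∘[ i ] y) ≈ extend (λ s → extend (λ u → φ (graft s i u)) y) x
  extend-∘ φ i []            y = refl
  extend-∘ φ i ((a , s) ∷ x) y = begin
    extend φ (((a , s) ∷ x) ∘[ i ] y)                              ≡⟨ ≡.cong (extend φ) (∘-cons i a s x y) ⟩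
    extend φ (([ a , s ] ∘[ i ] y) ++ (x ∘[ i ] y))           ≈⟨ extend-++ φ ([ a , s ] ∘[ i ] y) (x ∘[ i ] y) ⟩
    extend φ ([ a , s ] ∘[ i ] y) + extend φ (x ∘[ i ] y)     ≈⟨ +-cong (graft-s y) (extend-∘ φ i x y) ⟩
    a * extend (λ u → φ (graft s i u)) y + extend (λ s → extend (λ u → φ (graft s i u)) y) x ∎
    where
    graft-s : ∀ y → extend φ ([ a , s ] ∘[ i ] y) ≈ a * extend (λ u → φ (graft s i u)) y
    graft-s []            = sym (zeroʳ a)
    graft-s ((b , u) ∷ y) = trans (+-cong (*-assoc a b _) (graft-s y)) (sym (distribˡ a _ _))

  weight-∘ : ∀ i x y → weight (x ∘[ i ] y) ≈ weight x * weight y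
  weight-∘ i x y = trans (extend-∘ (λ _ → 1#) i x y) (extend-const (weight y) x)

  ∘-nullˡ : ∀ i x y → x ≋ [] → (x ∘[ i ] y) ≋ []
  ∘-nullˡ i x y x≋0 t =
    trans (coeff≈extend-δ (x ∘[ i ] y) t) (trans (extend-∘ (δ t) i x y) (extend-null _ x x≋0))

  ∘-nullʳ : ∀ i x y → y ≋ [] → (x ∘[ i ] y) ≋ []
  ∘-nullʳ i x y y≋0 t = begin
    coeff (x ∘[ i ] y) t                                      ≈⟨ coeff≈extend-δ (x ∘[ i ] y) t ⟩
    extend (δ t) (x ∘[ i ] y)                                 ≈⟨ extend-∘ (δ t) i x y ⟩
    extend (λ s → extend (λ u → δ t (graft s i u)) y) x
      ≈⟨ extend-cong x (All.universal (λ _ → extend-null _ y y≋0) x) ⟩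
    extend (λ _ → 0#) x                                       ≈⟨ extend-zero x ⟩
    0#                                                        ∎

  Hom-· : ∀ {n} b x → Hom n x → Hom n (b · x)
  Hom-· b x = All.map⁺

  Hom-∘ : ∀ {n m i} x y → i < n → Hom n x → Hom m y → Hom (n ℕ.+ m ∸ 1) (x ∘[ i ] y)
  Hom-∘ []            y i<n []            hy = []
  Hom-∘ {n} {m} {i} ((a , s) ∷ x) y i<n (ls≡n ∷ hx) hy =
    ≡.subst (Hom _) (≡.sym (∘-cons i a s x y)) (All.++⁺ (graft-s y hy) (Hom-∘ x y i<n hx hy))
    where
    leaves-graft-s : ∀ u → leaves u ≡ m → leaves (graft s i u) ≡ n ℕ.+ m ∸ 1
    leaves-graft-s u lu≡m = ≡.trans (≡.cong (_∸ 1) (leaves-graft s i u (≡.subst (i <_) (≡.sym ls≡n) i<n)))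
                                    (≡.cong₂ (λ p q → p ℕ.+ q ∸ 1) ls≡n lu≡m)
    graft-s : ∀ y → Hom m y → Hom (n ℕ.+ m ∸ 1) ([ a , s ] ∘[ i ] y)
    graft-s []            []            = []
    graft-s ((b , u) ∷ y) (lu≡m ∷ hy) = leaves-graft-s u lu≡m ∷ graft-s y hy

  Hom0⇒null : ∀ x → Hom 0 x → x ≋ []
  Hom0⇒null []            []          t = refl
  Hom0⇒null ((a , s) ∷ x) (ls≡0 ∷ _) t = ⊥-elim (leaves≢0 s ls≡0)

  coeff-Hom : ∀ {n} x t → Hom n x → leaves t ≢ n → coeff x t ≈ 0#
  coeff-Hom []            t []           lt≢n = refl
  coeff-Hom ((a , s) ∷ x) t (ls≡n ∷ hx) lt≢n =
    trans (reflexive (coeff-≢ a {s} {t} x s≢t)) (coeff-Hom x t hx lt≢n)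
    where
    s≢t : s ≢ t
    s≢t s≡t = lt≢n (≡.trans (≡.cong leaves (≡.sym s≡t)) ls≡n)

  extend-Hom1 : ∀ φ x → Hom 1 x → extend φ x ≈ weight x * φ leaf
  extend-Hom1 φ x hx = begin
    extend φ x               ≈⟨ extend-cong x (All.map (λ {p} → reflexive ∘ ≡.cong φ ∘ leaves≡1 (proj₂ p)) hx) ⟩
    extend (λ _ → φ leaf) x  ≈⟨ extend-const (φ leaf) x ⟩
    weight x * φ leaf        ∎

  extend-∘-unitʳ : ∀ φ i x {y} → Hom 1 y → extend φ (x ∘[ i ] y) ≈ extend φ x * weight y
  extend-∘-unitʳ φ i x {y} hy = begin
    extend φ (x ∘[ i ] y)                               ≈⟨ extend-∘ φ i x y ⟩
    extend (λ s → extend (λ u → φ (graft s i u)) y) x   ≈⟨ extend-cong x (All.universal inner x) ⟩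
    extend (λ s → φ s * weight y) x                     ≈⟨ extend-*ʳ φ (weight y) x ⟩
    extend φ x * weight y                               ∎
    where
    inner : ∀ p → extend (λ u → φ (graft (proj₂ p) i u)) y ≈ φ (proj₂ p) * weight y
    inner (_ , s) = begin
      extend (λ u → φ (graft s i u)) y  ≈⟨ extend-Hom1 (λ u → φ (graft s i u)) y hy ⟩
      weight y * φ (graft s i leaf)     ≡⟨ ≡.cong (λ s′ → weight y * φ s′) (graft-leaf s i) ⟩
      weight y * φ s                    ≈⟨ *-comm _ _ ⟩
      φ s * weight y                    ∎

  extend-∘-unitˡ : ∀ φ {x} y → Hom 1 x → extend φ (x ∘[ 0 ] y) ≈ weight x * extend φ y
  extend-∘-unitˡ φ {x} y hx =
    trans (extend-∘ φ 0 x y) (extend-Hom1 (λ s → extend (λ u → φ (graft s 0 u)) y) x hx)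

  -- Ideals generated by a family of formal sums

  module _ {G : ℕ → FS → Set (c ⊔ ℓ)} where

    ⟨⟩-mono : ∀ {H} → (∀ {n x} → G n x → ⟨ H ⟩ n x) → ∀ {n x} → ⟨ G ⟩ n x → ⟨ H ⟩ n x
    ⟨⟩-mono G⊆H (gen γ)         = G⊆H γ
    ⟨⟩-mono G⊆H zer             = zer
    ⟨⟩-mono G⊆H (add p q)       = add (⟨⟩-mono G⊆H p) (⟨⟩-mono G⊆H q)
    ⟨⟩-mono G⊆H (scale a p)     = scale a (⟨⟩-mono G⊆H p)
    ⟨⟩-mono G⊆H (resp e h p)    = resp e h (⟨⟩-mono G⊆H p)
    ⟨⟩-mono G⊆H (compL i<n p h) = compL i<n (⟨⟩-mono G⊆H p) h
    ⟨⟩-mono G⊆H (compR i<n h p) = compR i<n h (⟨⟩-mono G⊆H p)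

    ⟨⟩-weight≈0 : (∀ {n x} → G n x → weight x ≈ 0#) → ∀ {n x} → ⟨ G ⟩ n x → weight x ≈ 0#
    ⟨⟩-weight≈0 w (gen γ)                       = w γ
    ⟨⟩-weight≈0 w zer                           = refl
    ⟨⟩-weight≈0 w (add {x = x} {y} p q)         =
      trans (extend-++ _ x y) (trans (+-cong (⟨⟩-weight≈0 w p) (⟨⟩-weight≈0 w q)) (+-identityʳ 0#))
    ⟨⟩-weight≈0 w (scale {x = x} a p)           = trans (extend-· _ a x) (trans (*-congˡ (⟨⟩-weight≈0 w p)) (zeroʳ a))
    ⟨⟩-weight≈0 w (resp {x = x} {y} x≋y _ p)   = trans (sym (extend-resp-≋ _ {x} {y} x≋y)) (⟨⟩-weight≈0 w p)
    ⟨⟩-weight≈0 w (compL {x = x} {y} {i} _ p _) =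
      trans (weight-∘ i x y) (trans (*-congʳ (⟨⟩-weight≈0 w p)) (zeroˡ _))
    ⟨⟩-weight≈0 w (compR {x = x} {y} {i} _ _ q) =
      trans (weight-∘ i x y) (trans (*-congˡ (⟨⟩-weight≈0 w q)) (zeroʳ _))

    module _ {k} (G≥k : ∀ {n x} → G n x → k ≤ n) where

      ⟨⟩-null-below : ∀ {n x} → ⟨ G ⟩ n x → n < k → x ≋ []
      ⟨⟩-null-below (gen γ)                 n<k   = ⊥-elim (ℕ.<⇒≱ n<k (G≥k γ))
      ⟨⟩-null-below zer                     _   t = refl
      ⟨⟩-null-below (add {x = x} {y} p q)   n<k t =
        trans (coeff-++ x y t) (trans (+-cong (⟨⟩-null-below p n<k t) (⟨⟩-null-below q n<k t)) (+-identityʳ 0#))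
      ⟨⟩-null-below (scale {x = x} a p)     n<k t =
        trans (coeff-· a x t) (trans (*-congˡ (⟨⟩-null-below p n<k t)) (zeroʳ a))
      ⟨⟩-null-below (resp x≋y _ p)          n<k t = trans (sym (x≋y t)) (⟨⟩-null-below p n<k t)
      ⟨⟩-null-below (compL {m = zero} {x} {y} {i} _ _ hy) _ = ∘-nullʳ i x y (Hom0⇒null y hy)
      ⟨⟩-null-below (compL {n} {suc m} {x} {y} {i} _ p _) n+m<k =
        ∘-nullˡ i x y (⟨⟩-null-below p (ℕ.≤-<-trans (ℕ.m≤m+n n m) n+m<k′))
        where
        n+m<k′ : n ℕ.+ m < k
        n+m<k′ = ≡.subst (λ j → j ∸ 1 < k) (ℕ.+-suc n m) n+m<k
      ⟨⟩-null-below (compR {suc n} {m} {x} {y} {i} _ _ q) n+m<k =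
        ∘-nullʳ i x y (⟨⟩-null-below q (ℕ.≤-<-trans (ℕ.m≤n+m m n) n+m<k))

      -- A composite landing in the lowest arity k has a factor of arity 1, i.e. a scalar,
      -- so there the ideal is spanned by the generators.
      ⟨⟩-lowest-arity : ∀ φ → (∀ {x} → G k x → extend φ x ≈ 0#) →
                        ∀ {n x} → ⟨ G ⟩ n x → n ≡ k → extend φ x ≈ 0#
      ⟨⟩-lowest-arity φ φG (gen γ)               ≡.refl = φG γ
      ⟨⟩-lowest-arity φ φG zer                   _      = refl
      ⟨⟩-lowest-arity φ φG (add {x = x} {y} p q) n≡k    =
        trans (extend-++ φ x y)
              (trans (+-cong (⟨⟩-lowest-arity φ φG p n≡k) (⟨⟩-lowest-arity φ φG q n≡k)) (+-identityʳ 0#))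
      ⟨⟩-lowest-arity φ φG (scale {x = x} a p)   n≡k    =
        trans (extend-· φ a x) (trans (*-congˡ (⟨⟩-lowest-arity φ φG p n≡k)) (zeroʳ a))
      ⟨⟩-lowest-arity φ φG (resp {x = x} {y} x≋y _ p) n≡k =
        trans (sym (extend-resp-≋ φ {x} {y} x≋y)) (⟨⟩-lowest-arity φ φG p n≡k)
      ⟨⟩-lowest-arity φ φG (compL {m = zero} {x} {y} {i} _ _ hy) _ =
        extend-null φ (x ∘[ i ] y) (∘-nullʳ i x y (Hom0⇒null y hy))
      ⟨⟩-lowest-arity φ φG (compL {n} {suc zero} {x} {y} {i} _ p hy) n+1-1≡k = begin
        extend φ (x ∘[ i ] y)   ≈⟨ extend-∘-unitʳ φ i x hy ⟩
        extend φ x * weight y   ≈⟨ *-congʳ (⟨⟩-lowest-arity φ φG p (≡.trans (≡.sym (ℕ.m+n∸n≡m n 1)) n+1-1≡k)) ⟩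
        0# * weight y           ≈⟨ zeroˡ _ ⟩
        0#                      ∎
      ⟨⟩-lowest-arity φ φG (compL {n} {suc (suc m)} {x} {y} {i} _ p _) n+m+1≡k =
        extend-null φ (x ∘[ i ] y) (∘-nullˡ i x y (⟨⟩-null-below p n<k))
        where
        n<k : n < k
        n<k = ≡.subst (n <_) (≡.trans (≡.sym (≡.cong (_∸ 1) (ℕ.+-suc n (suc m)))) n+m+1≡k)
                      (ℕ.m<m+n n (s≤s z≤n))
      ⟨⟩-lowest-arity φ φG (compR {suc zero} {x = x} {y} {zero} _ hx q) m≡k = begin
        extend φ (x ∘[ 0 ] y)   ≈⟨ extend-∘-unitˡ φ y hx ⟩
        weight x * extend φ y   ≈⟨ *-congˡ (⟨⟩-lowest-arity φ φG q m≡k) ⟩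
        weight x * 0#           ≈⟨ zeroʳ _ ⟩
        0#                      ∎
      ⟨⟩-lowest-arity φ φG (compR {suc zero} {i = suc _} (s≤s ()) _ _) _
      ⟨⟩-lowest-arity φ φG (compR {suc (suc n)} {m} {x} {y} {i} _ _ q) n+m+1≡k =
        extend-null φ (x ∘[ i ] y) (∘-nullʳ i x y (⟨⟩-null-below q m<k))
        where
        m<k : m < k
        m<k = ≡.subst (m <_) n+m+1≡k (s≤s (ℕ.m≤n+m m n))

  _≈ᵗ_ : Carrier × Tree → Carrier × Tree → Set ℓ
  p ≈ᵗ q = proj₁ p ≈ proj₁ q × proj₂ p ≡ proj₂ q

  Pointwise⇒≋ : ∀ {x y} → Pointwise _≈ᵗ_ x y → x ≋ y
  Pointwise⇒≋ []                                             t = refl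
  Pointwise⇒≋ {(_ , s) ∷ _} ((a≈b , ≡.refl) ∷ x≈y) t with s ≟T t
  ... | yes _ = +-cong a≈b (Pointwise⇒≋ x≈y t)
  ... | no  _ = Pointwise⇒≋ x≈y t

  Pointwise-Hom : ∀ {n x y} → Pointwise _≈ᵗ_ x y → Hom n x → Hom n y
  Pointwise-Hom []                   []          = []
  Pointwise-Hom ((_ , ≡.refl) ∷ x≈y) (ls≡n ∷ hx) = ls≡n ∷ Pointwise-Hom x≈y hx

  _∘[_]ᵗ_ : FS → ℕ → Tree → FS
  x ∘[ i ]ᵗ u = map (map₂ (λ s → graft s i u)) x

  _ᵗ∘[_]_ : Tree → ℕ → FS → FS
  u ᵗ∘[ i ] y = map (map₂ (graft u i)) y

  _⊕_ : Tree → Tree → FS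
  s ⊕ t = (1# , s) ∷ (1# , t) ∷ []

  _⊖_ : Tree → Tree → FS
  s ⊖ t = (1# , s) ∷ (- 1# , t) ∷ []

  ∘-singletonʳ : ∀ i x u → Pointwise _≈ᵗ_ (x ∘[ i ] [ 1# , u ]) (x ∘[ i ]ᵗ u)
  ∘-singletonʳ i []            u = []
  ∘-singletonʳ i ((a , s) ∷ x) u = (*-identityʳ a , ≡.refl) ∷ ∘-singletonʳ i x u

  ∘-singletonˡ : ∀ i u y → Pointwise _≈ᵗ_ ([ 1# , u ] ∘[ i ] y) (u ᵗ∘[ i ] y)
  ∘-singletonˡ i u []            = []
  ∘-singletonˡ i u ((b , t) ∷ y) = (*-identityˡ b , ≡.refl) ∷ ∘-singletonˡ i u y

  module Ideal (G : ℕ → FS → Set (c ⊔ ℓ)) (G-hom : ∀ {n x} → G n x → Hom n x) where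

    ⟨⟩-hom : ∀ {n x} → ⟨ G ⟩ n x → Hom n x
    ⟨⟩-hom (gen γ)                        = G-hom γ
    ⟨⟩-hom zer                            = []
    ⟨⟩-hom (add p q)                      = All.++⁺ (⟨⟩-hom p) (⟨⟩-hom q)
    ⟨⟩-hom (scale {x = x} a p)            = Hom-· a x (⟨⟩-hom p)
    ⟨⟩-hom (resp _ h _)                   = h
    ⟨⟩-hom (compL {x = x} {y} i<n p hy)   = Hom-∘ x y i<n (⟨⟩-hom p) hy
    ⟨⟩-hom (compR {x = x} {y} i<n hx q)   = Hom-∘ x y i<n hx (⟨⟩-hom q)

    ⟨⟩-arity : ∀ {n m a s x} → leaves s ≡ m → ⟨ G ⟩ n ((a , s) ∷ x) → ⟨ G ⟩ m ((a , s) ∷ x)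
    ⟨⟩-arity ls≡m p with ⟨⟩-hom p
    ... | ls≡n ∷ _ = ≡.subst (λ n → ⟨ G ⟩ n _) (≡.trans (≡.sym ls≡n) ls≡m) p

    ⟨⟩-pointwise : ∀ {n x y} → Pointwise _≈ᵗ_ x y → ⟨ G ⟩ n x → ⟨ G ⟩ n y
    ⟨⟩-pointwise x≈y p = resp (Pointwise⇒≋ x≈y) (Pointwise-Hom x≈y (⟨⟩-hom p)) p

    ⟨⟩-graftˡ : ∀ {n x i} u → i < n → ⟨ G ⟩ n x → ⟨ G ⟩ (n ℕ.+ leaves u ∸ 1) (x ∘[ i ]ᵗ u)
    ⟨⟩-graftˡ {x = x} {i} u i<n p = ⟨⟩-pointwise (∘-singletonʳ i x u) (compL i<n p (≡.refl ∷ []))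

    ⟨⟩-graftʳ : ∀ {m y} u i → i < leaves u → ⟨ G ⟩ m y → ⟨ G ⟩ (leaves u ℕ.+ m ∸ 1) (u ᵗ∘[ i ] y)
    ⟨⟩-graftʳ {y = y} u i i<u q = ⟨⟩-pointwise (∘-singletonˡ i u y) (compR {x = (1# , u) ∷ []} i<u (≡.refl ∷ []) q)

    ⟨⟩-fill₄ : ∀ {x} → ⟨ G ⟩ 4 x → ∀ a b c d →
               ⟨ G ⟩ (leaves d ℕ.+ leaves c ℕ.+ leaves b ℕ.+ leaves a)
                     ((((x ∘[ 3 ]ᵗ d) ∘[ 2 ]ᵗ c) ∘[ 1 ]ᵗ b) ∘[ 0 ]ᵗ a)
    ⟨⟩-fill₄ p a b c d =
      ⟨⟩-graftˡ a (s≤s z≤n)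
        (⟨⟩-graftˡ b (s≤s (s≤s z≤n))
          (⟨⟩-graftˡ c (s≤s (s≤s (s≤s z≤n)))
            (⟨⟩-graftˡ d (s≤s (s≤s (s≤s (s≤s z≤n)))) p)))

    ⟨⟩-span : ∀ {n} → (∀ s → leaves s ≡ n → ⟨ G ⟩ n [ 1# , s ]) → ∀ x → Hom n x → ⟨ G ⟩ n x
    ⟨⟩-span trees []            []          = zer
    ⟨⟩-span trees ((a , s) ∷ x) (ls≡n ∷ hx) =
      ⟨⟩-pointwise ((*-identityʳ a , ≡.refl) ∷ Pointwise.refl (refl , ≡.refl))
                   (add (scale a (trees s ls≡n)) (⟨⟩-span trees x hx))

    _∼_ : Tree → Tree → Set (c ⊔ ℓ)
    s ∼ t = ⟨ G ⟩ (leaves s) (s ⊖ t)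

    ∼-leaves : ∀ {s t} → s ∼ t → leaves t ≡ leaves s
    ∼-leaves r with ⟨⟩-hom r
    ... | _ ∷ lt ∷ [] = lt

    ∼-refl : ∀ {s} → s ∼ s
    ∼-refl {s} = resp (≋-by-δ [] (s ⊖ s) λ t → solve 1 (λ d → 𝟘 := 𝟙 :* d :+ (:- 𝟙 :* d :+ 𝟘)) refl (δ t s))
                      (≡.refl ∷ ≡.refl ∷ []) zer

    ∼-sym : ∀ {s t} → s ∼ t → t ∼ s
    ∼-sym {s} {t} r = ⟨⟩-arity ≡.refl (resp t-s≋ (∼-leaves r ∷ ≡.refl ∷ []) (scale (- 1#) r))
      where
      t-s≋ : ((- 1#) · (s ⊖ t)) ≋ (t ⊖ s)
      t-s≋ = ≋-by-δ ((- 1#) · (s ⊖ t)) (t ⊖ s) λ u →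
        solve 2 (λ p q → :- 𝟙 :* 𝟙 :* p :+ (:- 𝟙 :* :- 𝟙 :* q :+ 𝟘) := 𝟙 :* q :+ (:- 𝟙 :* p :+ 𝟘))
                refl (δ u s) (δ u t)

    ∼-trans : ∀ {s t u} → s ∼ t → t ∼ u → s ∼ u
    ∼-trans {s} {t} {u} r₁ r₂ =
      resp s-u≋ (≡.refl ∷ ≡.trans (∼-leaves r₂) (∼-leaves r₁) ∷ [])
           (add r₁ (⟨⟩-arity (∼-leaves r₁) r₂))
      where
      s-u≋ : (s ⊖ t ++ t ⊖ u) ≋ (s ⊖ u)
      s-u≋ = ≋-by-δ (s ⊖ t ++ t ⊖ u) (s ⊖ u) λ v →
        solve 3 (λ p q r → 𝟙 :* p :+ (:- 𝟙 :* q :+ (𝟙 :* q :+ (:- 𝟙 :* r :+ 𝟘))) := 𝟙 :* p :+ (:- 𝟙 :* r :+ 𝟘))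
                refl (δ v s) (δ v t) (δ v u)

    ∼-isEquivalence : IsEquivalence _∼_
    ∼-isEquivalence = record { refl = ∼-refl ; sym = ∼-sym ; trans = ∼-trans }

    ∼-node-leaf : ∀ {s t} → s ∼ t → node leaf s ∼ node leaf t
    ∼-node-leaf = ⟨⟩-graftʳ C₂ 1 (s≤s (s≤s z≤n))

    ∼-fill₄ : ∀ {s t} → leaves s ≡ 4 → s ∼ t → ∀ a b c d → fill s a b c d ∼ fill t a b c d
    ∼-fill₄ ls≡4 r a b c d = ⟨⟩-arity ≡.refl (⟨⟩-fill₄ (⟨⟩-arity ls≡4 r) a b c d)

    module _ {n M} (lM≡n : leaves M ≡ n) (∼M : ∀ s → leaves s ≡ n → s ∼ M) where

      ⟨⟩-minus-weight : ∀ x → Hom n x → ⟨ G ⟩ n (x ++ [ - weight x , M ])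
      ⟨⟩-minus-weight []            []          =
        resp (≋-by-δ [] [ - 0# , M ] λ t → solve 1 (λ d → 𝟘 := :- 𝟘 :* d :+ 𝟘) refl (δ t M)) (lM≡n ∷ []) zer
      ⟨⟩-minus-weight ((a , s) ∷ x) (ls≡n ∷ hx) =
        resp shuffle (ls≡n ∷ All.++⁺ hx (lM≡n ∷ []))
             (add (scale a (⟨⟩-arity ls≡n (∼M s ls≡n))) (⟨⟩-minus-weight x hx))
        where
        shuffle : ((a * 1# , s) ∷ (a * - 1# , M) ∷ x ++ [ - weight x , M ])
                ≋ ((a , s) ∷ x ++ [ - (a * 1# + weight x) , M ])
        shuffle = ≋-by-δ ((a * 1# , s) ∷ (a * - 1# , M) ∷ x ++ [ - weight x , M ])
                         ((a , s) ∷ x ++ [ - (a * 1# + weight x) , M ]) λ t → begin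
          a * 1# * δ t s + (a * - 1# * δ t M + extend (δ t) (x ++ [ - weight x , M ]))
            ≈⟨ +-congˡ (+-congˡ (extend-++ (δ t) x _)) ⟩
          a * 1# * δ t s + (a * - 1# * δ t M + (extend (δ t) x + (- weight x * δ t M + 0#)))
            ≈⟨ solve 5 (λ a p q e w → a :* 𝟙 :* p :+ (a :* :- 𝟙 :* q :+ (e :+ (:- w :* q :+ 𝟘)))
                                     := a :* p :+ (e :+ (:- (a :* 𝟙 :+ w) :* q :+ 𝟘)))
                       refl a (δ t s) (δ t M) (extend (δ t) x) (weight x) ⟩
          a * δ t s + (extend (δ t) x + (- (a * 1# + weight x) * δ t M + 0#))
            ≈⟨ +-congˡ (extend-++ (δ t) x _) ⟨
          a * δ t s + extend (δ t) (x ++ [ - (a * 1# + weight x) , M ])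
            ∎

      weight≈0⇒⟨⟩ : ∀ x → Hom n x → weight x ≈ 0# → ⟨ G ⟩ n x
      weight≈0⇒⟨⟩ x hx w≈0 = resp drop-M hx (⟨⟩-minus-weight x hx)
        where
        drop-M : (x ++ [ - weight x , M ]) ≋ x
        drop-M = ≋-by-δ (x ++ [ - weight x , M ]) x λ t → begin
          extend (δ t) (x ++ [ - weight x , M ])      ≈⟨ extend-++ (δ t) x _ ⟩
          extend (δ t) x + (- weight x * δ t M + 0#)       ≈⟨ +-congˡ (+-identityʳ _) ⟩
          extend (δ t) x + - weight x * δ t M              ≈⟨ +-congˡ (*-congʳ (-‿cong w≈0)) ⟩
          extend (δ t) x + - 0# * δ t M                    ≈⟨ +-congˡ (*-congʳ -0#≈0#) ⟩
          extend (δ t) x + 0# * δ t M                      ≈⟨ +-congˡ (zeroˡ _) ⟩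
          extend (δ t) x + 0#                              ≈⟨ +-identityʳ _ ⟩
          extend (δ t) x                                   ∎

    ⊕-comm : ∀ {n s t} → ⟨ G ⟩ n (s ⊕ t) → ⟨ G ⟩ n (t ⊕ s)
    ⊕-comm {s = s} {t} p with ⟨⟩-hom p
    ... | ls≡n ∷ lt≡n ∷ [] =
      resp (≋-by-δ (s ⊕ t) (t ⊕ s) λ u →
              solve 2 (λ p q → 𝟙 :* p :+ (𝟙 :* q :+ 𝟘) := 𝟙 :* q :+ (𝟙 :* p :+ 𝟘)) refl (δ u s) (δ u t))
           (lt≡n ∷ ls≡n ∷ []) p

    ⊕-cancel : ∀ {n s t} → ⟨ G ⟩ n (s ⊕ t) → ⟨ G ⟩ n [ 1# , s ] → ⟨ G ⟩ n [ 1# , t ]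
    ⊕-cancel {s = s} {t} p q with ⟨⟩-hom p
    ... | _ ∷ lt≡n ∷ [] =
      resp (≋-by-δ (s ⊕ t ++ (- 1#) · [ 1# , s ]) [ 1# , t ] λ u →
              solve 2 (λ p q → 𝟙 :* p :+ (𝟙 :* q :+ (:- 𝟙 :* 𝟙 :* p :+ 𝟘)) := 𝟙 :* q :+ 𝟘) refl (δ u s) (δ u t))
           (lt≡n ∷ []) (add p (scale (- 1#) q))

    ⊕-odd-cycle : ∀ {h} → (1# + 1#) * h ≈ 1# → ∀ {n a b c d e} →
                  ⟨ G ⟩ n (a ⊕ b) → ⟨ G ⟩ n (b ⊕ c) → ⟨ G ⟩ n (c ⊕ d) →
                  ⟨ G ⟩ n (d ⊕ e) → ⟨ G ⟩ n (e ⊕ a) → ⟨ G ⟩ n [ 1# , a ]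
    ⊕-odd-cycle {h} 2h≈1 {a = a} {b} {c} {d} {e} ab bc cd de ea with ⟨⟩-hom ab
    ... | la≡n ∷ _ =
      resp (≋-by-δ alternating [ 1# , a ] λ t → begin
             extend (δ t) alternating
               ≈⟨ solve 6 (λ h a b c d e →
                      h :* 𝟙 :* a :+ (h :* 𝟙 :* b :+ (h :* (:- 𝟙 :* 𝟙) :* b :+ (h :* (:- 𝟙 :* 𝟙) :* c :+
                      (h :* 𝟙 :* c :+ (h :* 𝟙 :* d :+ (h :* (:- 𝟙 :* 𝟙) :* d :+ (h :* (:- 𝟙 :* 𝟙) :* e :+
                      (h :* 𝟙 :* e :+ (h :* 𝟙 :* a :+ 𝟘)))))))))
                      := (𝟙 :+ 𝟙) :* h :* a :+ 𝟘)
                    refl h (δ t a) (δ t b) (δ t c) (δ t d) (δ t e) ⟩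
             (1# + 1#) * h * δ t a + 0#
               ≈⟨ +-congʳ (*-congʳ 2h≈1) ⟩
             1# * δ t a + 0#
               ∎)
           (la≡n ∷ []) (scale h (add ab (add (scale (- 1#) bc) (add cd (add (scale (- 1#) de) ea)))))
      where
      alternating : FS
      alternating = h · (a ⊕ b ++ ((- 1#) · (b ⊕ c) ++ (c ⊕ d ++ ((- 1#) · (d ⊕ e) ++ e ⊕ a))))

  G-As-hom : ∀ {n x} → G-As n x → Hom n x
  G-As-hom g = ≡.refl ∷ ≡.refl ∷ []

  G-AAs-hom : ∀ {n x} → G-AAs n x → Hom n x
  G-AAs-hom g = ≡.refl ∷ ≡.refl ∷ []

  G-2Nil-hom : ∀ {n x} → G-2Nil n x → Hom n x
  G-2Nil-hom gL = ≡.refl ∷ []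
  G-2Nil-hom gR = ≡.refl ∷ []

  G-RC₃-hom : ∀ {n x} → G-RC₃ n x → Hom n x
  G-RC₃-hom (g t lt≡4) = lt≡4 ∷ ≡.refl ∷ []

  G-As-weight≈0 : ∀ {n x} → G-As n x → weight x ≈ 0#
  G-As-weight≈0 g = solve 0 (𝟙 :* 𝟙 :+ (:- 𝟙 :* 𝟙 :+ 𝟘) := 𝟘) refl

  G-As-arity : ∀ {n x} → G-As n x → 3 ≤ n
  G-As-arity g = ℕ.≤-refl

  G-AAs-arity : ∀ {n x} → G-AAs n x → 3 ≤ n
  G-AAs-arity g = ℕ.≤-refl

  G-2Nil-arity : ∀ {n x} → G-2Nil n x → 3 ≤ n
  G-2Nil-arity gL = ℕ.≤-refl
  G-2Nil-arity gR = ℕ.≤-refl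

  module As   = Ideal G-As G-As-hom
  module AAs  = Ideal G-AAs G-AAs-hom
  module 2Nil = Ideal G-2Nil G-2Nil-hom
  module RC₃  = Ideal G-RC₃ G-RC₃-hom

  As⊆2Nil : ∀ {n x} → I-As n x → I-2Nil n x
  As⊆2Nil = ⟨⟩-mono λ { g → 2Nil.⟨⟩-pointwise ((refl , ≡.refl) ∷ (*-identityʳ (- 1#) , ≡.refl) ∷ [])
                                                (add (gen gL) (scale (- 1#) (gen gR))) }

  AAs⊆2Nil : ∀ {n x} → I-AAs n x → I-2Nil n x
  AAs⊆2Nil = ⟨⟩-mono λ { g → add (gen gL) (gen gR) }

  As-rotate : ∀ a b c → node (node a b) c As.∼ node a (node b c)
  As-rotate a b c =
    As.⟨⟩-arity ≡.refl
      (As.⟨⟩-graftˡ a (s≤s z≤n)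
        (As.⟨⟩-graftˡ b (s≤s (s≤s z≤n))
          (As.⟨⟩-graftˡ c (s≤s (s≤s (s≤s z≤n))) (gen g))))

  As-∼RComb₂ : ∀ t → leaves t ≡ 3 → t As.∼ RComb₂
  As-∼RComb₂ t lt≡3 with leaves≡3 t lt≡3
  ... | inj₁ ≡.refl = gen g
  ... | inj₂ ≡.refl = As.∼-refl

  module As-normal = RightCombNormalForm As.∼-isEquivalence 2 (λ a b c _ → As-rotate a b c) As.∼-node-leaf As-∼RComb₂

  RC₃⊆As : ∀ {n x} → I-RC₃ n x → I-As n x
  RC₃⊆As = ⟨⟩-mono λ { (g t lt≡4) → As.⟨⟩-arity lt≡4 (As-normal.∼RComb 3 t lt≡4 (s≤s (s≤s z≤n))) }

  RC₃-∼RComb₃ : ∀ t → leaves t ≡ 4 → t RC₃.∼ RComb₃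
  RC₃-∼RComb₃ t lt≡4 = RC₃.⟨⟩-arity ≡.refl (gen (g t lt≡4))

  RC₃-fill₄ : ∀ s t → leaves s ≡ 4 → leaves t ≡ 4 → ∀ a b c d → fill s a b c d RC₃.∼ fill t a b c d
  RC₃-fill₄ s t ls≡4 lt≡4 =
    RC₃.∼-fill₄ ls≡4 (RC₃.∼-trans (RC₃-∼RComb₃ s ls≡4) (RC₃.∼-sym (RC₃-∼RComb₃ t lt≡4)))

  RC₃-rotate : ∀ a b c → 4 ≤ leaves a ℕ.+ leaves b ℕ.+ leaves c → node (node a b) c RC₃.∼ node a (node b c)
  RC₃-rotate (node a₁ a₂) b            c            _ = RC₃-fill₄ T₁ T₃ ≡.refl ≡.refl a₁ a₂ b c
  RC₃-rotate leaf         (node b₁ b₂) c            _ = RC₃-fill₄ T₂ T₄ ≡.refl ≡.refl leaf b₁ b₂ c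
  RC₃-rotate leaf         leaf         (node c₁ c₂) _ = RC₃-fill₄ T₃ T₅ ≡.refl ≡.refl leaf leaf c₁ c₂
  RC₃-rotate leaf         leaf         leaf         (s≤s (s≤s (s≤s ())))

  module RC₃-normal = RightCombNormalForm RC₃.∼-isEquivalence 3 RC₃-rotate RC₃.∼-node-leaf RC₃-∼RComb₃

  weight≈0⇒RC₃ : ∀ {n} x → 4 ≤ n → Hom n x → weight x ≈ 0# → I-RC₃ n x
  weight≈0⇒RC₃ {suc n} x (s≤s 3≤n) =
    RC₃.weight≈0⇒⟨⟩ (leaves-RComb n) (λ s ls≡1+n → RC₃-normal.∼RComb n s ls≡1+n 3≤n) x

  normal₃ : FS → FS
  normal₃ x = (coeff x LComb₂ , LComb₂) ∷ (coeff x RComb₂ , RComb₂) ∷ []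

  arity3-normal : ∀ x → Hom 3 x → x ≋ normal₃ x
  arity3-normal x hx t with LComb₂ ≟T t
  ... | yes ≡.refl = sym (+-identityʳ _)
  ... | no  L≢t with RComb₂ ≟T t
  ...   | yes ≡.refl = sym (+-identityʳ _)
  ...   | no  R≢t    = coeff-Hom x t hx lt≢3
    where
    lt≢3 : leaves t ≢ 3
    lt≢3 lt≡3 with leaves≡3 t lt≡3
    ... | inj₁ t≡L = L≢t (≡.sym t≡L)
    ... | inj₂ t≡R = R≢t (≡.sym t≡R)

  AAs-T₁⊕T₃ : I-AAs 4 (T₁ ⊕ T₃)
  AAs-T₁⊕T₃ = AAs.⟨⟩-graftˡ C₂ (s≤s z≤n) (gen g)

  AAs-T₂⊕T₄ : I-AAs 4 (T₂ ⊕ T₄)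
  AAs-T₂⊕T₄ = AAs.⟨⟩-graftˡ C₂ (s≤s (s≤s z≤n)) (gen g)

  AAs-T₃⊕T₅ : I-AAs 4 (T₃ ⊕ T₅)
  AAs-T₃⊕T₅ = AAs.⟨⟩-graftˡ C₂ (s≤s (s≤s (s≤s z≤n))) (gen g)

  AAs-T₁⊕T₂ : I-AAs 4 (T₁ ⊕ T₂)
  AAs-T₁⊕T₂ = AAs.⟨⟩-graftʳ C₂ 0 (s≤s z≤n) (gen g)

  AAs-T₄⊕T₅ : I-AAs 4 (T₄ ⊕ T₅)
  AAs-T₄⊕T₅ = AAs.⟨⟩-graftʳ C₂ 1 (s≤s (s≤s z≤n)) (gen g)

  module _ {h} (2h≈1 : (1# + 1#) * h ≈ 1#) where

    -- T₁ – T₂ – T₄ – T₅ – T₃ – T₁ is the associahedron pentagon, a cycle of odd length.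
    AAs-T₁ : I-AAs 4 [ 1# , T₁ ]
    AAs-T₁ = AAs.⊕-odd-cycle 2h≈1 AAs-T₁⊕T₂ AAs-T₂⊕T₄ AAs-T₄⊕T₅
                             (AAs.⊕-comm AAs-T₃⊕T₅) (AAs.⊕-comm AAs-T₁⊕T₃)

    AAs-four-leaf : ∀ {T} → FourLeaf T → I-AAs 4 [ 1# , T ]
    AAs-four-leaf t₁ = AAs-T₁
    AAs-four-leaf t₂ = AAs.⊕-cancel AAs-T₁⊕T₂ AAs-T₁
    AAs-four-leaf t₃ = AAs.⊕-cancel AAs-T₁⊕T₃ AAs-T₁
    AAs-four-leaf t₄ = AAs.⊕-cancel AAs-T₂⊕T₄ (AAs.⊕-cancel AAs-T₁⊕T₂ AAs-T₁)
    AAs-four-leaf t₅ = AAs.⊕-cancel AAs-T₃⊕T₅ (AAs.⊕-cancel AAs-T₁⊕T₃ AAs-T₁)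

    AAs-tree : ∀ {n} t → leaves t ≡ n → 4 ≤ n → I-AAs n [ 1# , t ]
    AAs-tree t lt≡n 4≤n with filled-four-leaf t (≡.subst (4 ≤_) (≡.sym lt≡n) 4≤n)
    ... | filled T a b c d = AAs.⟨⟩-arity lt≡n (AAs.⟨⟩-fill₄ (AAs-four-leaf T) a b c d)

    arity≥4⇒AAs : ∀ {n} x → 4 ≤ n → Hom n x → I-AAs n x
    arity≥4⇒AAs x 4≤n = AAs.⟨⟩-span (λ s ls≡n → AAs-tree s ls≡n 4≤n) x

    RC₃⊆AAs : ∀ {n x} → I-RC₃ n x → I-AAs n x
    RC₃⊆AAs = ⟨⟩-mono λ { (g t lt≡4) → AAs.⟨⟩-pointwise ((refl , ≡.refl) ∷ (*-identityʳ (- 1#) , ≡.refl) ∷ [])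
                                          (add (AAs-tree t lt≡4 ℕ.≤-refl) (scale (- 1#) (AAs-four-leaf t₅))) }

    x+y≈0∧x-y≈0⇒x≈0∧y≈0 : ∀ x y → x + y ≈ 0# → x - y ≈ 0# → x ≈ 0# × y ≈ 0#
    x+y≈0∧x-y≈0⇒x≈0∧y≈0 u v u+v≈0 u-v≈0 =
        halve u (solve 2 (λ u v → u :+ u := (u :+ v) :+ (u :- v)) refl u v) (+-cong u+v≈0 u-v≈0)
      , halve v (solve 2 (λ u v → v :+ v := (u :+ v) :- (u :- v)) refl u v) (+-cong u+v≈0 (trans (-‿cong u-v≈0) -0#≈0#))
      where
      halve : ∀ w {p q} → w + w ≈ p + q → p + q ≈ 0# + 0# → w ≈ 0#
      halve w w+w≈ ≈0+0 = begin
        w                      ≈⟨ *-identityˡ w ⟨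
        1# * w                 ≈⟨ *-congʳ 2h≈1 ⟨
        (1# + 1#) * h * w      ≈⟨ solve 2 (λ h w → (𝟙 :+ 𝟙) :* h :* w := h :* (w :+ w)) refl h w ⟩
        h * (w + w)            ≈⟨ *-congˡ (trans w+w≈ (trans ≈0+0 (+-identityʳ 0#))) ⟩
        h * 0#                 ≈⟨ zeroʳ h ⟩
        0#                     ∎

    arity3⇒As+AAs : ∀ x → Hom 3 x → (I-As +I I-AAs) 3 x
    arity3⇒As+AAs x hx = α · (LComb₂ ⊖ RComb₂) , β · (LComb₂ ⊕ RComb₂) , scale α (gen g) , scale β (gen g) ,
                         λ t → trans (arity3-normal x hx t) (decomposition t)
      where
      cL cR α β : Carrier
      cL = coeff x LComb₂
      cR = coeff x RComb₂
      α = h * (cL - cR)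
      β = h * (cL + cR)
      twice-half : ∀ u → u ≈ (1# + 1#) * h * u
      twice-half u = trans (sym (*-identityˡ u)) (*-congʳ (sym 2h≈1))
      decomposition : normal₃ x ≋ (α · (LComb₂ ⊖ RComb₂) ++ β · (LComb₂ ⊕ RComb₂))
      decomposition = ≋-by-δ (normal₃ x) (α · (LComb₂ ⊖ RComb₂) ++ β · (LComb₂ ⊕ RComb₂)) λ t → begin
        cL * δ t LComb₂ + (cR * δ t RComb₂ + 0#)
          ≈⟨ +-cong (*-congʳ (twice-half cL)) (+-congʳ (*-congʳ (twice-half cR))) ⟩
        (1# + 1#) * h * cL * δ t LComb₂ + ((1# + 1#) * h * cR * δ t RComb₂ + 0#)
          ≈⟨ solve 5 (λ h a b p q → (𝟙 :+ 𝟙) :* h :* a :* p :+ ((𝟙 :+ 𝟙) :* h :* b :* q :+ 𝟘)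
                                  := h :* (a :- b) :* 𝟙 :* p :+ (h :* (a :- b) :* :- 𝟙 :* q :+
                                     (h :* (a :+ b) :* 𝟙 :* p :+ (h :* (a :+ b) :* 𝟙 :* q :+ 𝟘))))
                     refl h cL cR (δ t LComb₂) (δ t RComb₂) ⟩
        α * 1# * δ t LComb₂ + (α * - 1# * δ t RComb₂ + (β * 1# * δ t LComb₂ + (β * 1# * δ t RComb₂ + 0#)))
          ∎

    arity3-As∩AAs⇒null : ∀ x → Hom 3 x → I-As 3 x → I-AAs 3 x → x ≋ []
    arity3-As∩AAs⇒null x hx p q t = begin
      coeff x t                                     ≈⟨ arity3-normal x hx t ⟩
      coeff (normal₃ x) t                           ≈⟨ coeff≈extend-δ (normal₃ x) t ⟩
      cL * δ t LComb₂ + (cR * δ t RComb₂ + 0#)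
        ≈⟨ +-cong (*-congʳ (proj₁ cL≈0×cR≈0)) (+-congʳ (*-congʳ (proj₂ cL≈0×cR≈0))) ⟩
      0# * δ t LComb₂ + (0# * δ t RComb₂ + 0#)
        ≈⟨ solve 2 (λ p q → 𝟘 :* p :+ (𝟘 :* q :+ 𝟘) := 𝟘) refl (δ t LComb₂) (δ t RComb₂) ⟩
      0#                                            ∎
      where
      cL cR : Carrier
      cL = coeff x LComb₂
      cR = coeff x RComb₂
      φ : Tree → Carrier
      φ s = δ LComb₂ s - δ RComb₂ s
      φ-generator : ∀ {y} → G-AAs 3 y → extend φ y ≈ 0#
      φ-generator g = solve 0 (𝟙 :* (𝟙 :- 𝟘) :+ (𝟙 :* (𝟘 :- 𝟙) :+ 𝟘) := 𝟘) refl
      sum≈0 : cL + cR ≈ 0#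
      sum≈0 = begin
        cL + cR                          ≈⟨ solve 2 (λ a b → a :+ b := a :* 𝟙 :+ (b :* 𝟙 :+ 𝟘)) refl cL cR ⟩
        weight (normal₃ x)               ≈⟨ extend-resp-≋ (λ _ → 1#) {x} {normal₃ x} (arity3-normal x hx) ⟨
        weight x                         ≈⟨ ⟨⟩-weight≈0 G-As-weight≈0 p ⟩
        0#                               ∎
      difference≈0 : cL - cR ≈ 0#
      difference≈0 = begin
        cL - cR               ≈⟨ solve 2 (λ a b → a :- b := a :* (𝟙 :- 𝟘) :+ (b :* (𝟘 :- 𝟙) :+ 𝟘)) refl cL cR ⟩
        extend φ (normal₃ x)  ≈⟨ extend-resp-≋ φ {x} {normal₃ x} (arity3-normal x hx) ⟨
        extend φ x            ≈⟨ ⟨⟩-lowest-arity G-AAs-arity φ φ-generator q ≡.refl ⟩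
        0#                    ∎
      cL≈0×cR≈0 : cL ≈ 0# × cR ≈ 0#
      cL≈0×cR≈0 = x+y≈0∧x-y≈0⇒x≈0∧y≈0 cL cR sum≈0 difference≈0

    sum≐2Nil : (I-As +I I-AAs) ≐ I-2Nil
    sum≐2Nil n x hx = mk⇔ to from
      where
      to : (I-As +I I-AAs) n x → I-2Nil n x
      to (y , z , p , q , x≋y++z) = resp (λ t → sym (x≋y++z t)) hx (add (As⊆2Nil p) (AAs⊆2Nil q))
      from : I-2Nil n x → (I-As +I I-AAs) n x
      from r with ℕ.<-cmp n 3
      ... | tri< n<3 _ _    = [] , [] , zer , zer , ⟨⟩-null-below G-2Nil-arity r n<3
      ... | tri≈ _ ≡.refl _ = arity3⇒As+AAs x hx
      ... | tri> _ _ 3<n    = [] , x , zer , arity≥4⇒AAs x 3<n hx , λ t → refl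

    intersection≐RC₃ : (I-As ∩I I-AAs) ≐ I-RC₃
    intersection≐RC₃ n x hx = mk⇔ to (λ r → RC₃⊆As r , RC₃⊆AAs r)
      where
      to : (I-As ∩I I-AAs) n x → I-RC₃ n x
      to (p , q) with ℕ.<-cmp n 3
      ... | tri< n<3 _ _    = resp (λ t → sym (⟨⟩-null-below G-As-arity p n<3 t)) hx zer
      ... | tri≈ _ ≡.refl _ = resp (λ t → sym (arity3-As∩AAs⇒null x hx p q t)) hx zer
      ... | tri> _ _ 3<n    = weight≈0⇒RC₃ x 3<n hx (⟨⟩-weight≈0 G-As-weight≈0 p)

theorem2p2p3 : ∀ {c ℓ} (F : Field c ℓ) → CharZero F →
    let open LinMag F in
    ((I-As +I I-AAs) ≐ I-2Nil) × ((I-As ∩I I-AAs) ≐ I-RC₃)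
theorem2p2p3 F charZero = sum≐2Nil F 2h≈1 , intersection≐RC₃ F 2h≈1
  where
  open Field F
  2≉0 : ¬ (1# + 1# ≈ 0#)
  2≉0 2≈0 = charZero 1 (trans (+-congˡ (+-identityʳ 1#)) 2≈0)
  half : ∃[ h ] (1# + 1#) * h ≈ 1#
  half = inverse (1# + 1#) 2≉0
  2h≈1 : (1# + 1#) * proj₁ half ≈ 1#
  2h≈1 = proj₂ half
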